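{- Let $\varphi=\bigwedge_{i=1}^m C_i$ be a satisfiable CNF formula with $p$ prime implicates. Let $x_1,\dots,x_m$ be new variables (not occurring in $\varphi$) and let $$\psi=\bigwedge_{i=1}^{m-1}(\neg x_i\vee x_{i+1})\wedge(\neg x_m\vee x_1)\wedge\bigwedge_{i=1}^m(\neg x_i\vee C_i).$$ Then the number of prime implicates of $\psi$ is $mp+m(m-1)$ and the size of a smallest PC representation of $\psi$ is $p+m$.
   Context: Size of a CNF is its number of clauses. A PC representation of $\psi$ is an equivalent CNF on the same variables that is propagation complete: for every partial assignment $\alpha$ (set of literals with no complementary pair, viewed as their conjunction) and literal $l$ with $\psi'\wedge\alpha\models l$, we have $\psi'\wedge\alpha\vdash_1 l$ or $\psi'\wedge\alpha\vdash_1\bot$, where $\vdash_1$ is derivability by repeated unit resolution (deriving $C\setminus\{l\}$ from $C\ni l$ and $\neg l$) and $\bot$ is the empty clause. -}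

module Defs where

open import Data.Nat using (ℕ; zero; suc; _∸_; _≟_)
open import Data.Bool using (Bool; true; false; not)
open import Data.List using (List; []; _∷_; _++_; map; upTo; filter; length)
open import Data.List.Membership.Propositional using (_∈_; _∉_)
open import Data.List.Relation.Unary.All using (All)
open import Data.List.Relation.Unary.Any using (Any)
open import Data.List.Relation.Unary.AllPairs using (AllPairs)
open import Data.Product using (Σ; ∃; _×_; _,_)
open import Data.Sum using (_⊎_)
open import Relation.Nullary using (¬_; Dec; yes; no)
open import Relation.Binary.PropositionalEquality using (_≡_; _≢_; refl; cong)
open import Data.Nat using (_≤_)

data Lit : Set where
  pos : ℕ → Lit
  neg : ℕ → Lit

var : Lit → ℕ
var (pos v) = v
var (neg v) = v

compl : Lit → Lit
compl (pos v) = neg v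
compl (neg v) = pos v

_≟L_ : (a b : Lit) → Dec (a ≡ b)
pos a ≟L pos b with a ≟ b
... | yes refl = yes refl
... | no ne = no λ { refl → ne refl }
neg a ≟L neg b with a ≟ b
... | yes refl = yes refl
... | no ne = no λ { refl → ne refl }
pos a ≟L neg b = no λ ()
neg a ≟L pos b = no λ ()

-- A clause is a disjunction of literals, represented by a list
-- (considered as the set of its members).
Clause : Set
Clause = List Lit

CNF : Set
CNF = List Clause

_⊆C_ : Clause → Clause → Set
C ⊆C D = ∀ {l} → l ∈ C → l ∈ D

_≈C_ : Clause → Clause → Set
C ≈C D = (C ⊆C D) × (D ⊆C C)

NonTaut : Clause → Set
NonTaut C = ∀ {l} → l ∈ C → compl l ∉ C

Assignment : Set
Assignment = ℕ → Bool

evalLit : Assignment → Lit → Bool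
evalLit v (pos x) = v x
evalLit v (neg x) = not (v x)

SatC : Assignment → Clause → Set
SatC v C = Any (λ l → evalLit v l ≡ true) C

Sat : Assignment → CNF → Set
Sat v F = All (SatC v) F

Satisfiable : CNF → Set
Satisfiable F = ∃ λ v → Sat v F

_⊨_ : CNF → Clause → Set
F ⊨ C = ∀ (v : Assignment) → Sat v F → SatC v C

Equivalent : CNF → CNF → Set
Equivalent F G = ∀ (v : Assignment) → (Sat v F → Sat v G) × (Sat v G → Sat v F)

OccursIn : ℕ → CNF → Set
OccursIn y F = Any (Any (λ l → var l ≡ y)) F

PrimeImplicate : CNF → Clause → Set
PrimeImplicate F C =
  NonTaut C × (F ⊨ C) ×
  (∀ D → D ⊆C C → ¬ (C ⊆C D) → ¬ (F ⊨ D))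

NumPrimeImplicates : CNF → ℕ → Set
NumPrimeImplicates F p =
  Σ (List Clause) λ L →
    (length L ≡ p) ×
    All (PrimeImplicate F) L ×
    (∀ C → PrimeImplicate F C → Any (λ D → C ≈C D) L) ×
    AllPairs (λ C D → ¬ (C ≈C D)) L

remove : Lit → Clause → Clause
remove l C = filter (λ k → Relation.Nullary.¬? (k ≟L l)) C

IsUnit : Lit → Clause → Set
IsUnit l D = (D ≢ []) × All (λ k → k ≡ l) D

data _⊢₁_ (F : CNF) : Clause → Set where
  axiom : ∀ {C} → C ∈ F → F ⊢₁ C
  unitRes : ∀ {C D l} → F ⊢₁ C → l ∈ C → F ⊢₁ D → IsUnit (compl l) D →
            F ⊢₁ remove l C

_⊢₁lit_ : CNF → Lit → Set
F ⊢₁lit l = ∃ λ D → (F ⊢₁ D) × IsUnit l D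

_⊢₁⊥ : CNF → Set
F ⊢₁⊥ = F ⊢₁ []

-- Partial assignments: lists of literals with no complementary pair
Consistent : List Lit → Set
Consistent α = ∀ {l} → l ∈ α → compl l ∉ α

units : List Lit → CNF
units α = map (λ l → l ∷ []) α

PropagationComplete : CNF → Set
PropagationComplete F =
  ∀ (α : List Lit) → Consistent α → ∀ (l : Lit) →
    (F ++ units α) ⊨ (l ∷ []) →
    ((F ++ units α) ⊢₁lit l) ⊎ ((F ++ units α) ⊢₁⊥)

PCRepresentation : CNF → CNF → Set
PCRepresentation F G =
  Equivalent F G ×
  (∀ y → OccursIn y G → OccursIn y F) ×
  PropagationComplete G

MinPCSize : CNF → ℕ → Set
MinPCSize F k =
  (Σ CNF λ G → PCRepresentation F G × length G ≡ k) ×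
  (∀ G → PCRepresentation F G → k ≤ length G)

-- The construction (indices shifted to 0 … m-1)

phi : ℕ → (ℕ → Clause) → CNF
phi m C = map C (upTo m)

psi : ℕ → (ℕ → Clause) → (ℕ → ℕ) → CNF
psi m C x =
  map (λ i → neg (x i) ∷ pos (x (suc i)) ∷ []) (upTo (m ∸ 1)) ++
  ((neg (x (m ∸ 1)) ∷ pos (x 0) ∷ []) ∷ []) ++
  map (λ i → neg (x i) ∷ C i) (upTo m)

{-# OPTIONS --safe #-}
module Submission where

-- The cycle makes all xᵢ equivalent under ψ: if they are false ψ is satisfied, and if they are true
-- ψ reduces to φ. Hence the prime implicates of ψ are exactly the clauses ¬xᵢ ∨ E with E a prime
-- implicate of φ and ¬xᵢ ∨ xⱼ with i ≢ j, which gives m·p + m(m − 1) of them.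
-- The p clauses ¬x₀ ∨ E together with the m cycle clauses form a PC representation: under a partial
-- assignment α that sets some xₐ, unit propagation along the cycle derives every xⱼ, and a prime E
-- inside the negation of α (plus the queried literal) is resolved away from ¬x₀ ∨ E; if α sets no xₐ,
-- only literals of α and literals ¬xⱼ are implied, and those are reached through ¬x₀ ∨ E and the cycle.
-- Conversely, a PC representation must propagate ¬x₀ from the complement of each prime E of φ, which
-- needs a clause equivalent to ¬xₖ ∨ E, and must propagate xⱼ from some xₐ with a ≢ j, which needs a
-- clause whose only positive x-literal is xⱼ; these p + m clauses are pairwise distinct.

open import Defs
open import Data.Nat using (ℕ; zero; suc; pred; _≤_; _<_; _+_; _*_; _∸_; z≤n; s≤s; _≟_; _≤′_; ≤′-refl; ≤′-step)
open import Data.Nat.Properties using (*-distribˡ-+; m∸n+n≡m; ≤-refl; <-trans; <⇒≤pred; ≤-pred; <⇒≤; <-≤-trans; m<n⇒m<1+n; ≤⇒≤′; module ≤-Reasoning)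
open import Data.Bool using (Bool; true; false; not)
open import Data.Bool.Properties using (not-involutive; ¬-not) renaming (_≟_ to _≟B_)
open import Data.List using (List; []; _∷_; _++_; map; length; filter; upTo; concatMap)
open import Data.List.Properties using (≡-dec; length-++; length-map; length-upTo; filter-none; filter-notAll; filter-all; filter-accept; filter-reject)
open import Data.List.Membership.Propositional using (_∈_; _∉_; find; lose)
open import Data.List.Membership.DecPropositional _≟L_ using (_∈?_)
open import Data.List.Membership.Propositional.Properties
  using (∈-filter⁺; ∈-filter⁻; ∈-++⁺ˡ; ∈-++⁺ʳ; ∈-++⁻; ∈-map⁺; ∈-map⁻; ∈-upTo⁺; ∈-upTo⁻; ∈-concatMap⁺; ∈-concatMap⁻)
open import Data.List.Relation.Binary.Subset.Propositional using (_⊆_)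
open import Data.List.Relation.Binary.Subset.DecPropositional _≟L_ using (_⊆?_)
open import Data.List.Relation.Unary.All as All using (All; []; _∷_)
open import Data.List.Relation.Unary.All.Properties using (¬All⇒Any¬)
import Data.List.Relation.Unary.All.Properties as All
open import Data.List.Relation.Unary.Any as Any using (Any; here; there)
open import Data.List.Relation.Unary.Any.Properties using (singleton⁻)
open import Data.List.Relation.Unary.AllPairs as AllPairs using (AllPairs; []; _∷_)
import Data.List.Relation.Unary.AllPairs.Properties as AllPairs
open import Data.List.Relation.Unary.Unique.Propositional using (Unique)
open import Data.List.Relation.Unary.Unique.Propositional.Properties using (upTo⁺) renaming (filter⁺ to Unique-filter⁺; ++⁺ to Unique-++⁺)
open import Data.Product using (Σ; ∃; _×_; _,_; proj₁; proj₂)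
open import Data.Sum as Sum using (_⊎_; inj₁; inj₂)
open import Data.Empty using (⊥; ⊥-elim)
open import Relation.Nullary using (¬_; Dec; yes; no; ¬?)
open import Relation.Nullary.Decidable using (map′; does; decidable-stable; ¬¬-excluded-middle)
open import Relation.Nullary.Negation using (contradiction)
open import Relation.Binary.Definitions using (DecidableEquality)
open import Relation.Unary using (Decidable)
open import Function using (id; _∘′_; case_of_)
open import Relation.Binary.PropositionalEquality using (_≡_; _≢_; refl; sym; trans; cong; cong₂; subst; module ≡-Reasoning)

<pred⇒< : ∀ {i n} → i < pred n → i < n
<pred⇒< {n = suc _} i<n = m<n⇒m<1+n i<n

<pred⇒suc< : ∀ {i n} → i < pred n → suc i < n
<pred⇒suc< {n = suc _} i<n = s≤s i<n

pred< : ∀ {n} → 0 < n → pred n < n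
pred< {suc _} _ = ≤-refl

climb : ∀ {P : ℕ → Set} {b} → (∀ i → i < b → P i → P (suc i)) →
  ∀ {a} → P a → ∀ {j} → a ≤ j → j ≤ b → P j
climb {P} {b} step {a} Pa a≤j = go (≤⇒≤′ a≤j)
  where
  go : ∀ {j} → a ≤′ j → j ≤ b → P j
  go ≤′-refl _ = Pa
  go (≤′-step a≤′j) j<b = step _ j<b (go a≤′j (<⇒≤ j<b))

descend : ∀ {P : ℕ → Set} {b} → (∀ i → i < b → P (suc i) → P i) → P b → ∀ {j} → j ≤ b → P j
descend {P} step Pb {j} j≤b = go step Pb (≤⇒≤′ j≤b)
  where
  go : ∀ {b} → (∀ i → i < b → P (suc i) → P i) → P b → j ≤′ b → P j
  go _ Pb ≤′-refl = Pb
  go step Pb (≤′-step j≤′b) = go (λ i i<b → step i (m<n⇒m<1+n i<b)) (step _ ≤-refl Pb) j≤′b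

∃<? : ∀ {P : ℕ → Set} n → Decidable P → Dec (∃ λ k → k < n × P k)
∃<? n P? = map′ (λ any → let k , k∈ , Pk = find any in k , ∈-upTo⁻ k∈ , Pk)
                (λ (k , k<n , Pk) → lose (∈-upTo⁺ k<n) Pk)
                (Any.any? P? (upTo n))

length-concatMap : ∀ {A B : Set} (f : A → List B) {k} xs → (∀ {a} → a ∈ xs → length (f a) ≡ k) →
  length (concatMap f xs) ≡ length xs * k
length-concatMap f [] _ = refl
length-concatMap f (a ∷ xs) len = trans (length-++ (f a)) (cong₂ _+_ (len (here refl)) (length-concatMap f xs (len ∘′ there)))

module _ {A B : Set} {R : A → A → Set} {S : B → B → Set} where

  map-AllPairs : ∀ (f : A → B) {xs} → (∀ {a a′} → a ∈ xs → a′ ∈ xs → R a a′ → S (f a) (f a′)) →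
    AllPairs R xs → AllPairs S (map f xs)
  map-AllPairs f h [] = []
  map-AllPairs f h (Ra ∷ Rs) =
    All.map⁺ (All.tabulate λ a′∈ → h (here refl) (there a′∈) (All.lookup Ra a′∈))
    ∷ map-AllPairs f (λ a∈ a′∈ → h (there a∈) (there a′∈)) Rs

concatMap-AllPairs : ∀ {A B : Set} {S : B → B → Set} (f : A → List B) {xs} → Unique xs →
  (∀ {a} → a ∈ xs → AllPairs S (f a)) →
  (∀ {a a′ b b′} → a ∈ xs → a′ ∈ xs → a ≢ a′ → b ∈ f a → b′ ∈ f a′ → S b b′) →
  AllPairs S (concatMap f xs)
concatMap-AllPairs f [] _ _ = []
concatMap-AllPairs f {a ∷ xs} (a∉xs ∷ u) inner cross =
  AllPairs.++⁺ (inner (here refl)) (concatMap-AllPairs f u (inner ∘′ there) λ a∈ a′∈ → cross (there a∈) (there a′∈))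
    (All.tabulate λ b∈ → All.tabulate λ b′∈ →
      let a′ , a′∈ , b′∈fa′ = find (∈-concatMap⁻ f b′∈) in
      cross (here refl) (there a′∈) (All.lookup a∉xs a′∈) b∈ b′∈fa′)

module _ {A : Set} (_≟_ : DecidableEquality A) where

  Unique-⊆⇒length≤ : ∀ {xs ys : List A} → Unique xs → xs ⊆ ys → length xs ≤ length ys
  Unique-⊆⇒length≤ {[]} _ _ = z≤n
  Unique-⊆⇒length≤ {x ∷ xs} {ys} (x∉xs ∷ uxs) x∷xs⊆ys = begin-strict
    length xs                             ≤⟨ Unique-⊆⇒length≤ uxs xs⊆ys∖x ⟩
    length (filter (λ y → ¬? (y ≟ x)) ys) <⟨ filter-notAll _ ys (Any.map (λ e y≢x → y≢x (sym e)) (x∷xs⊆ys (here refl))) ⟩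
    length ys                             ∎
    where
    open ≤-Reasoning
    xs⊆ys∖x : xs ⊆ filter (λ y → ¬? (y ≟ x)) ys
    xs⊆ys∖x y∈ = ∈-filter⁺ _ (x∷xs⊆ys (there y∈)) λ { refl → All.lookup x∉xs y∈ refl }

  length-filter-≢ : ∀ {x xs} → Unique xs → x ∈ xs → suc (length (filter (λ y → ¬? (y ≟ x)) xs)) ≡ length xs
  length-filter-≢ {x} {y ∷ xs} (y∉xs ∷ _) (here refl) = begin
    suc (length (filter (λ y → ¬? (y ≟ x)) (y ∷ xs))) ≡⟨ cong (suc ∘′ length) (filter-reject (λ y → ¬? (y ≟ x)) (λ y≢x → y≢x refl)) ⟩
    suc (length (filter (λ y → ¬? (y ≟ x)) xs))       ≡⟨ cong (suc ∘′ length) (filter-all (λ y → ¬? (y ≟ x)) (All.map (λ y≢z z≡y → y≢z (sym z≡y)) y∉xs)) ⟩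
    suc (length xs)                                   ∎
    where open ≡-Reasoning
  length-filter-≢ {x} {y ∷ xs} (y∉xs ∷ u) (there x∈xs) = begin
    suc (length (filter (λ y → ¬? (y ≟ x)) (y ∷ xs))) ≡⟨ cong (suc ∘′ length) (filter-accept (λ y → ¬? (y ≟ x)) λ { refl → All.lookup y∉xs x∈xs refl }) ⟩
    suc (suc (length (filter (λ y → ¬? (y ≟ x)) xs))) ≡⟨ cong suc (length-filter-≢ u x∈xs) ⟩
    suc (length xs)                                   ∎
    where open ≡-Reasoning

module _ {A B : Set} {P : A → B → Set} where

  witnesses : ∀ {xs} → All (λ a → Σ B (P a)) xs → List B
  witnesses = All.reduce proj₁

  length-witnesses : ∀ {xs} (ws : All (λ a → Σ B (P a)) xs) → length (witnesses ws) ≡ length xs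
  length-witnesses [] = refl
  length-witnesses (_ ∷ ws) = cong suc (length-witnesses ws)

  ∈-witnesses⁻ : ∀ {xs} (ws : All (λ a → Σ B (P a)) xs) {b} → b ∈ witnesses ws → ∃ λ a → a ∈ xs × P a b
  ∈-witnesses⁻ ((_ , pb) ∷ _) (here refl) = _ , here refl , pb
  ∈-witnesses⁻ (_ ∷ ws) (there b∈) with a , a∈ , pab ← ∈-witnesses⁻ ws b∈ = a , there a∈ , pab

  witnesses-Unique : ∀ {R : A → A → Set} {xs} (ws : All (λ a → Σ B (P a)) xs) → AllPairs R xs →
    (∀ {a a′ b b′} → a ∈ xs → a′ ∈ xs → R a a′ → P a b → P a′ b′ → b ≢ b′) → Unique (witnesses ws)
  witnesses-Unique [] [] _ = []
  witnesses-Unique ((b , pb) ∷ ws) (Rxs ∷ Rs) distinct =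
    All.tabulate (λ b′∈ → let a′ , a′∈ , pb′ = ∈-witnesses⁻ ws b′∈ in
                   distinct (here refl) (there a′∈) (All.lookup Rxs a′∈) pb pb′)
    ∷ witnesses-Unique ws Rs λ a∈ a′∈ → distinct (there a∈) (there a′∈)

compl-involutive : ∀ l → compl (compl l) ≡ l
compl-involutive (pos _) = refl
compl-involutive (neg _) = refl

compl-injective : ∀ {k l} → compl k ≡ compl l → k ≡ l
compl-injective {pos _} {pos _} refl = refl
compl-injective {neg _} {neg _} refl = refl

compl-≢ : ∀ l → compl l ≢ l
compl-≢ (pos _) ()
compl-≢ (neg _) ()

≡⊎≡compl : ∀ k l → var k ≡ var l → k ≡ l ⊎ k ≡ compl l
≡⊎≡compl (pos _) (pos _) refl = inj₁ refl
≡⊎≡compl (pos _) (neg _) refl = inj₂ refl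
≡⊎≡compl (neg _) (pos _) refl = inj₂ refl
≡⊎≡compl (neg _) (neg _) refl = inj₁ refl

evalLit-compl : ∀ v l → evalLit v (compl l) ≡ not (evalLit v l)
evalLit-compl v (pos _) = refl
evalLit-compl v (neg y) = sym (not-involutive (v y))

true⇒compl-false : ∀ v l → evalLit v l ≡ true → evalLit v (compl l) ≡ false
true⇒compl-false v l t = trans (evalLit-compl v l) (cong not t)

false⇒compl-true : ∀ v l → evalLit v l ≡ false → evalLit v (compl l) ≡ true
false⇒compl-true v l f = trans (evalLit-compl v l) (cong not f)

¬both-true : ∀ v l → evalLit v l ≡ true → evalLit v (compl l) ≡ true → ⊥
¬both-true v l t t̅ with () ← trans (sym t̅) (true⇒compl-false v l t)

compl-true⇒false : ∀ v l → evalLit v (compl l) ≡ true → evalLit v l ≡ false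
compl-true⇒false v l t̅ with evalLit v l in eq
... | false = refl
... | true = ⊥-elim (¬both-true v l eq t̅)

evalLit-cong : ∀ {v w} l → v (var l) ≡ w (var l) → evalLit v l ≡ evalLit w l
evalLit-cong (pos _) eq = eq
evalLit-cong (neg _) eq = cong not eq

∈-remove⁺ : ∀ {k l C} → k ∈ C → k ≢ l → k ∈ remove l C
∈-remove⁺ {l = l} k∈C k≢l = ∈-filter⁺ (λ k → ¬? (k ≟L l)) k∈C k≢l

∈-remove⁻ : ∀ {k l} C → k ∈ remove l C → k ∈ C × k ≢ l
∈-remove⁻ {l = l} C = ∈-filter⁻ (λ k → ¬? (k ≟L l)) {xs = C}

remove-⊆ : ∀ l C → remove l C ⊆C C
remove-⊆ l C = proj₁ ∘′ ∈-remove⁻ C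

length-remove< : ∀ {l C} → l ∈ C → length (remove l C) < length C
length-remove< {l} {C} l∈C = filter-notAll (λ k → ¬? (k ≟L l)) C (Any.map (λ e k≢l → k≢l (sym e)) l∈C)

NonTaut-⊆ : ∀ {C D} → D ⊆C C → NonTaut C → NonTaut D
NonTaut-⊆ D⊆C ntC l∈D l̅∈D = ntC (D⊆C l∈D) (D⊆C l̅∈D)

NonTaut-∷ : ∀ {l E} → compl l ∉ E → NonTaut E → NonTaut (l ∷ E)
NonTaut-∷ {l} _ _ (here refl) (here eq) = compl-≢ l eq
NonTaut-∷ l̅∉E _ (here refl) (there l̅∈E) = l̅∉E l̅∈E
NonTaut-∷ {l} {E} l̅∉E _ {k} (there k∈E) (here eq) =
  l̅∉E (subst (_∈ E) (trans (sym (compl-involutive k)) (cong compl eq)) k∈E)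
NonTaut-∷ _ ntE (there k∈E) (there k̅∈E) = ntE k∈E k̅∈E

-- NonTaut and Consistent are the same predicate, so this also makes map compl C a consistent partial assignment.
NonTaut-map-compl : ∀ {C} → NonTaut C → NonTaut (map compl C)
NonTaut-map-compl {C} ntC k∈ k̅∈
  with a , a∈ , refl ← ∈-map⁻ compl k∈
     | b , b∈ , eq ← ∈-map⁻ compl k̅∈
  = ntC a∈ (subst (_∈ C) (sym (compl-injective eq)) b∈)

Consistent-∷-compl : ∀ {α l} → Consistent α → l ∉ α → Consistent (compl l ∷ α)
Consistent-∷-compl {l = l} cons l∉α (here refl) (here eq) = compl-≢ (compl l) eq
Consistent-∷-compl {α} {l} cons l∉α (here refl) (there q) = l∉α (subst (_∈ α) (compl-involutive l) q)
Consistent-∷-compl cons l∉α (there a∈) (here eq) = l∉α (subst (_∈ _) (compl-injective eq) a∈)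
Consistent-∷-compl cons l∉α (there a∈) (there q) = cons a∈ q

∈-map-compl⇒compl∈ : ∀ {l D} → l ∈ map compl D → compl l ∈ D
∈-map-compl⇒compl∈ {D = D} l∈ with a , a∈D , refl ← ∈-map⁻ compl l∈ = subst (_∈ D) (sym (compl-involutive a)) a∈D

∈-map-compl⁻ : ∀ {l D} → compl l ∈ map compl D → l ∈ D
∈-map-compl⁻ {D = D} l̅∈ with a , a∈D , eq ← ∈-map⁻ compl l̅∈ = subst (_∈ D) (sym (compl-injective eq)) a∈D

⊈⇒∃∉ : ∀ {C D} → ¬ (C ⊆C D) → ∃ λ l → l ∈ C × l ∉ D
⊈⇒∃∉ {C} {D} C⊈D = find (¬All⇒Any¬ (_∈? D) C (λ all → C⊈D (All.lookup all)))

tautology? : ∀ C → (∃ λ l → l ∈ C × compl l ∈ C) ⊎ NonTaut C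
tautology? C with Any.any? (λ l → compl l ∈? C) C
... | yes taut = inj₁ (find taut)
... | no ¬taut = inj₂ λ l∈ l̅∈ → ¬taut (lose l∈ l̅∈)

occurs? : ∀ y F → Dec (OccursIn y F)
occurs? y F = Any.any? (Any.any? (λ l → var l ≟ y)) F

SatC-⊆ : ∀ {v D D′} → D ⊆C D′ → SatC v D → SatC v D′
SatC-⊆ D⊆D′ s with l , l∈ , t ← find s = lose (D⊆D′ l∈) t

⊨-weaken : ∀ {F D D′} → F ⊨ D → D ⊆C D′ → F ⊨ D′
⊨-weaken F⊨D D⊆D′ v s = SatC-⊆ D⊆D′ (F⊨D v s)

SatC-cong : ∀ {v w} D → (∀ {l} → l ∈ D → v (var l) ≡ w (var l)) → SatC v D → SatC w D
SatC-cong D agree s with l , l∈ , t ← find s = lose l∈ (trans (sym (evalLit-cong l (agree l∈))) t)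

Sat-cong : ∀ {v w} F → (∀ y → OccursIn y F → v y ≡ w y) → Sat v F → Sat w F
Sat-cong [] agree [] = []
Sat-cong (D ∷ F) agree (sD ∷ sF) =
  SatC-cong D (λ l∈ → agree _ (here (lose l∈ refl))) sD ∷ Sat-cong F (λ y o → agree y (there o)) sF

Sat-units⁺ : ∀ {v} α → (∀ {a} → a ∈ α → evalLit v a ≡ true) → Sat v (units α)
Sat-units⁺ α t = All.map⁺ (All.tabulate (λ a∈ → here (t a∈)))

Sat-units⁻ : ∀ {v} α → Sat v (units α) → ∀ {a} → a ∈ α → evalLit v a ≡ true
Sat-units⁻ (_ ∷ _) (here t ∷ _) (here refl) = t
Sat-units⁻ (_ ∷ α) (_ ∷ s) (there a∈) = Sat-units⁻ α s a∈

SatC-tautology : ∀ v {C l} → l ∈ C → compl l ∈ C → SatC v C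
SatC-tautology v {l = l} l∈ l̅∈ with evalLit v l in eq
... | true = lose l∈ eq
... | false = lose l̅∈ (false⇒compl-true v l eq)

SatC-implication : ∀ {v y z} → SatC v (neg y ∷ pos z ∷ []) → v y ≡ true → v z ≡ true
SatC-implication (here ¬vy) vy with () ← trans (sym ¬vy) (cong not vy)
SatC-implication (there (here vz)) _ = vz

⊨-units⇒⊨-compl : ∀ {F} α {l} → (F ++ units α) ⊨ (l ∷ []) → F ⊨ (l ∷ map compl α)
⊨-units⇒⊨-compl {F} α imp v s with All.all? (λ a → evalLit v a ≟B true) α
... | yes αtrue = here (singleton⁻ (imp v (All.++⁺ s (Sat-units⁺ α (All.lookup αtrue)))))
... | no ¬αtrue with a , a∈ , ¬t ← find (¬All⇒Any¬ (λ a → evalLit v a ≟B true) α ¬αtrue) =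
  there (lose (∈-map⁺ compl a∈) (false⇒compl-true v a (¬-not ¬t)))

model : List Lit → Assignment
model α y = does (pos y ∈? α)

model-satisfies : ∀ {α} → Consistent α → ∀ {a} → a ∈ α → evalLit (model α) a ≡ true
model-satisfies {α} cons {pos y} a∈ with pos y ∈? α
... | yes _ = refl
... | no y∉ = contradiction a∈ y∉
model-satisfies {α} cons {neg y} a∈ with pos y ∈? α
... | yes y∈ = contradiction y∈ (cons a∈)
... | no _ = refl

model-false : ∀ {α} y → pos y ∉ α → model α y ≡ false
model-false {α} y y∉ with pos y ∈? α
... | yes y∈ = contradiction y∈ y∉
... | no _ = refl

falsifier-falsifies : ∀ {C} → NonTaut C → ∀ {l} → l ∈ C → evalLit (model (map compl C)) l ≡ false
falsifier-falsifies ntC {l} l∈ =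
  compl-true⇒false _ l (model-satisfies (NonTaut-map-compl ntC) (∈-map⁺ compl l∈))

override : {P : ℕ → Set} → Decidable P → Bool → Assignment → Assignment
override P? b v y with P? y
... | yes _ = b
... | no _ = v y

override-inside : ∀ {P : ℕ → Set} (P? : Decidable P) b v {y} → P y → override P? b v y ≡ b
override-inside P? b v {y} Py with P? y
... | yes _ = refl
... | no ¬Py = contradiction Py ¬Py

override-outside : ∀ {P : ℕ → Set} (P? : Decidable P) b v {y} → ¬ P y → override P? b v y ≡ v y
override-outside P? b v {y} ¬Py with P? y
... | yes Py = contradiction Py ¬Py
... | no _ = refl

polarity : Lit → Bool
polarity (pos _) = true
polarity (neg _) = false

evalLit-against-polarity : ∀ v l → v (var l) ≡ not (polarity l) → evalLit v l ≡ false
evalLit-against-polarity v (pos _) eq = eq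
evalLit-against-polarity v (neg _) eq = cong not eq

⊢₁-sound : ∀ {F D} → F ⊢₁ D → F ⊨ D
⊢₁-sound (axiom D∈F) v s = All.lookup s D∈F
⊢₁-sound (unitRes {l = l} ⊢C l∈C ⊢U (_ , U≡l̅)) v s
  with c , c∈C , ct ← find (⊢₁-sound ⊢C v s)
     | u , u∈U , ut ← find (⊢₁-sound ⊢U v s)
  = lose (∈-remove⁺ c∈C c≢l) ct
  where
  c≢l : c ≢ l
  c≢l refl = ¬both-true v c ct (subst (λ k → evalLit v k ≡ true) (All.lookup U≡l̅ u∈U) ut)

⊢₁lit-sound : ∀ {F u} → F ⊢₁lit u → F ⊨ (u ∷ [])
⊢₁lit-sound (D , ⊢D , _ , D≡u) v s with d , d∈D , dt ← find (⊢₁-sound ⊢D v s) =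
  here (subst (λ k → evalLit v k ≡ true) (All.lookup D≡u d∈D) dt)

⊢₁lit-axiom : ∀ {F a} → (a ∷ []) ∈ F → F ⊢₁lit a
⊢₁lit-axiom a∈F = _ , axiom a∈F , (λ ()) , refl ∷ []

⊢₁-clash : ∀ {F l} → F ⊢₁lit l → F ⊢₁lit compl l → F ⊢₁⊥
⊢₁-clash {F} {l} (.l ∷ D , ⊢D , _ , refl ∷ D≡l) (_ , ⊢U , unitU) =
  subst (F ⊢₁_) (filter-none (λ k → ¬? (k ≟L l)) (All.map (λ k≡l k≢l → k≢l k≡l) (refl ∷ D≡l)))
    (unitRes ⊢D (here refl) ⊢U unitU)
⊢₁-clash ([] , _ , []≢[] , _) _ = contradiction refl []≢[]

⊢₁-binary : ∀ {F C a b} → C ∈ F → C ⊆C (a ∷ b ∷ []) → a ∈ C → b ∈ C → b ≢ a →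
  F ⊢₁lit compl a → F ⊢₁lit b
⊢₁-binary {C = C} {a} {b} C∈F C⊆ab a∈C b∈C b≢a (_ , ⊢U , unitU) =
  remove a C , unitRes (axiom C∈F) a∈C ⊢U unitU , nonempty , All.tabulate only-b
  where
  nonempty : remove a C ≢ []
  nonempty eq with () ← subst (b ∈_) eq (∈-remove⁺ b∈C b≢a)
  only-b : ∀ {k} → k ∈ remove a C → k ≡ b
  only-b k∈ with k∈C , k≢a ← ∈-remove⁻ C k∈ with C⊆ab k∈C
  ... | here k≡a = contradiction k≡a k≢a
  ... | there (here k≡b) = k≡b

resolve-away : ∀ {F C} → F ⊢₁ C → (S : List Lit) → (∀ {s} → s ∈ S → F ⊢₁lit compl s) →
  ∃ λ C′ → F ⊢₁ C′ × C′ ⊆C C × (∀ {k} → k ∈ C′ → k ∉ S)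
resolve-away ⊢C [] _ = _ , ⊢C , id , λ _ ()
resolve-away ⊢C (s ∷ S) ⊢S̅ with resolve-away ⊢C S (⊢S̅ ∘′ there)
... | C′ , ⊢C′ , C′⊆C , C′∩S=∅ with s ∈? C′
...   | no s∉C′ = C′ , ⊢C′ , C′⊆C , λ { k∈ (here refl) → s∉C′ k∈ ; k∈ (there k∈S) → C′∩S=∅ k∈ k∈S }
...   | yes s∈C′ with _ , ⊢U , unitU ← ⊢S̅ (here refl) =
  remove s C′ , unitRes ⊢C′ s∈C′ ⊢U unitU , C′⊆C ∘′ remove-⊆ s C′ , disjoint
  where
  disjoint : ∀ {k} → k ∈ remove s C′ → k ∉ s ∷ S
  disjoint k∈ (here refl) = proj₂ (∈-remove⁻ C′ k∈) refl
  disjoint k∈ (there k∈S) = C′∩S=∅ (proj₁ (∈-remove⁻ C′ k∈)) k∈S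

resolve-to-unit : ∀ {F C} u → F ⊢₁ C → (S : List Lit) → (∀ {s} → s ∈ S → F ⊢₁lit compl s) →
  (∀ {k} → k ∈ C → k ∈ S ⊎ k ≡ u) → F ⊢₁lit u ⊎ F ⊢₁⊥
resolve-to-unit u ⊢C S ⊢S̅ C⊆S∪u with resolve-away ⊢C S ⊢S̅
... | [] , ⊢[] , _ = inj₂ ⊢[]
... | c ∷ C′ , ⊢C′ , C′⊆C , C′∩S=∅ = inj₁ (c ∷ C′ , ⊢C′ , (λ ()) , All.tabulate is-u)
  where
  is-u : ∀ {k} → k ∈ c ∷ C′ → k ≡ u
  is-u k∈ with C⊆S∪u (C′⊆C k∈)
  ... | inj₁ k∈S = contradiction k∈S (C′∩S=∅ k∈)
  ... | inj₂ k≡u = k≡u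

-- If var l did not occur in F, flipping it so as to falsify l would show that F already implies E without l.
prime-implicate-var-occurs : ∀ {F E} → PrimeImplicate F E → ∀ {l} → l ∈ E → OccursIn (var l) F
prime-implicate-var-occurs {F} {E} (ntE , F⊨E , minE) {l} l∈E =
  decidable-stable (occurs? (var l) F) λ ¬occ →
    minE (remove l E) (remove-⊆ l E) (λ E⊆ → proj₂ (∈-remove⁻ E (E⊆ l∈E)) refl) (F⊨E∖l ¬occ)
  where
  w : Assignment → Assignment
  w = override (_≟ var l) (not (polarity l))
  off-l : ∀ v {y} → y ≢ var l → w v y ≡ v y
  off-l v = override-outside (_≟ var l) _ v
  l-false : ∀ v → evalLit (w v) l ≡ false
  l-false v = evalLit-against-polarity (w v) l (override-inside (_≟ var l) _ v refl)
  F⊨E∖l : ¬ OccursIn (var l) F → F ⊨ remove l E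
  F⊨E∖l ¬occ v s
    with c , c∈E , ct ← find (F⊨E (w v) (Sat-cong F (λ y o → sym (off-l v λ { refl → ¬occ o })) s)) =
    lose (∈-remove⁺ c∈E c≢l) (trans (evalLit-cong c (sym (off-l v var-c≢var-l))) ct)
    where
    c≢l : c ≢ l
    c≢l refl with () ← trans (sym ct) (l-false v)
    var-c≢var-l : var c ≢ var l
    var-c≢var-l eq with ≡⊎≡compl c l eq
    ... | inj₁ c≡l = c≢l c≡l
    ... | inj₂ refl = ntE l∈E c∈E

-- Only doubly negated: whether F ⊨ D can be shrunk is not decidable, since assignments are infinite.
prime-implicate-⊆ : ∀ {F D} → F ⊨ D → NonTaut D → ¬ ¬ (∃ λ E → PrimeImplicate F E × E ⊆C D)
prime-implicate-⊆ {F} {D} = go (length D) ≤-refl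
  where
  go : ∀ n {D} → length D ≤ n → F ⊨ D → NonTaut D → ¬ ¬ (∃ λ E → PrimeImplicate F E × E ⊆C D)
  go n {D} len F⊨D ntD no-prime = ¬¬-excluded-middle λ
    { (yes shrinkable) → shrink n len (find shrinkable)
    ; (no ¬shrinkable) → no-prime (D , (ntD , F⊨D , minimal ¬shrinkable) , id) }
    where
    minimal : ¬ Any (λ l → F ⊨ remove l D) D → ∀ D′ → D′ ⊆C D → ¬ (D ⊆C D′) → ¬ (F ⊨ D′)
    minimal ¬shrinkable D′ D′⊆D D⊈D′ F⊨D′ with l , l∈D , l∉D′ ← ⊈⇒∃∉ D⊈D′ =
      ¬shrinkable (lose l∈D (⊨-weaken F⊨D′ λ d∈ → ∈-remove⁺ (D′⊆D d∈) λ { refl → l∉D′ d∈ }))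
    shrink : ∀ n → length D ≤ n → (∃ λ l → l ∈ D × F ⊨ remove l D) → ⊥
    shrink zero len (_ , l∈D , _) with () ← <-≤-trans (length-remove< l∈D) len
    shrink (suc n) len (l , l∈D , F⊨D∖l) =
      go n (≤-pred (<-≤-trans (length-remove< l∈D) len)) F⊨D∖l (NonTaut-⊆ (remove-⊆ l D) ntD)
        λ (E , pE , E⊆) → no-prime (E , pE , remove-⊆ l D ∘′ E⊆)

prime-implicate-minimal : ∀ {F D K} → PrimeImplicate F D → K ⊆C D → F ⊨ K → D ⊆C K
prime-implicate-minimal {D = D} {K} (_ , _ , minD) K⊆D F⊨K =
  decidable-stable (D ⊆? K) λ D⊈K → minD K K⊆D D⊈K F⊨K

module Cycle (m : ℕ) (x : ℕ → ℕ) where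

  step-clause : ℕ → Clause
  step-clause i = neg (x i) ∷ pos (x (suc i)) ∷ []

  wrap-clause : Clause
  wrap-clause = neg (x (m ∸ 1)) ∷ pos (x 0) ∷ []

  CycleIn : CNF → Set
  CycleIn H = (∀ {i} → i < m ∸ 1 → step-clause i ∈ H) × wrap-clause ∈ H

  module _ {H : CNF} (cycle : CycleIn H) where

    private
      steps : ∀ {i} → i < m ∸ 1 → step-clause i ∈ H
      steps = proj₁ cycle
      wrap : wrap-clause ∈ H
      wrap = proj₂ cycle

    cycle-true : ∀ {v} → Sat v H → ∀ {a} → a < m → v (x a) ≡ true → ∀ {j} → j < m → v (x j) ≡ true
    cycle-true {v} s a<m xa j<m =
      climb forward (SatC-implication (All.lookup s wrap) (climb forward xa (<⇒≤pred a<m) ≤-refl))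
        z≤n (<⇒≤pred j<m)
      where
      forward : ∀ i → i < m ∸ 1 → v (x i) ≡ true → v (x (suc i)) ≡ true
      forward i i<m-1 = SatC-implication (All.lookup s (steps i<m-1))

    cycle-⊢₁pos : ∀ {F} → H ⊆ F → ∀ {a} → a < m → F ⊢₁lit pos (x a) → ∀ {j} → j < m → F ⊢₁lit pos (x j)
    cycle-⊢₁pos H⊆F a<m ⊢xa j<m =
      climb forward (wrap-forward (climb forward ⊢xa (<⇒≤pred a<m) ≤-refl)) z≤n (<⇒≤pred j<m)
      where
      forward : ∀ i → i < m ∸ 1 → _ ⊢₁lit pos (x i) → _ ⊢₁lit pos (x (suc i))
      forward i i<m-1 = ⊢₁-binary (H⊆F (steps i<m-1)) id (here refl) (there (here refl)) (λ ())
      wrap-forward : _ ⊢₁lit pos (x (m ∸ 1)) → _ ⊢₁lit pos (x 0)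
      wrap-forward = ⊢₁-binary (H⊆F wrap) id (here refl) (there (here refl)) (λ ())

    cycle-⊢₁neg : ∀ {F} → H ⊆ F → ∀ {b} → b < m → F ⊢₁lit neg (x b) → ∀ {j} → j < m → F ⊢₁lit neg (x j)
    cycle-⊢₁neg H⊆F b<m ⊢¬xb j<m =
      descend backward (wrap-backward (descend (λ i i<b → backward i (<-≤-trans i<b (<⇒≤pred b<m))) ⊢¬xb z≤n))
        (<⇒≤pred j<m)
      where
      swap : ∀ {a b : Lit} → (a ∷ b ∷ []) ⊆C (b ∷ a ∷ [])
      swap (here refl) = there (here refl)
      swap (there (here refl)) = here refl
      backward : ∀ i → i < m ∸ 1 → _ ⊢₁lit neg (x (suc i)) → _ ⊢₁lit neg (x i)
      backward i i<m-1 = ⊢₁-binary (H⊆F (steps i<m-1)) swap (there (here refl)) (here refl) (λ ())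
      wrap-backward : _ ⊢₁lit neg (x 0) → _ ⊢₁lit neg (x (m ∸ 1))
      wrap-backward = ⊢₁-binary (H⊆F wrap) swap (there (here refl)) (here refl) (λ ())

module Construction
  (m : ℕ) (2≤m : 2 ≤ m) (C : ℕ → Clause) (x : ℕ → ℕ)
  (x-injective : ∀ i j → i < m → j < m → x i ≡ x j → i ≡ j)
  (x-fresh : ∀ i → i < m → ¬ OccursIn (x i) (phi m C))
  (φ-satisfiable : Satisfiable (phi m C))
  (L : List Clause)
  (L-prime : All (PrimeImplicate (phi m C)) L)
  (L-complete : ∀ D → PrimeImplicate (phi m C) D → Any (λ E → D ≈C E) L)
  (L-distinct : AllPairs (λ D E → ¬ (D ≈C E)) L)
  where

  open Cycle m x

  φ ψ : CNF
  φ = phi m C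
  ψ = psi m C x

  x⁺ x⁻ : ℕ → Lit
  x⁺ i = pos (x i)
  x⁻ i = neg (x i)

  0<m : 0 < m
  0<m = <-trans (s≤s z≤n) 2≤m

  ψ-cycle : CycleIn ψ
  ψ-cycle = (λ i<m-1 → ∈-++⁺ˡ (∈-map⁺ step-clause (∈-upTo⁺ i<m-1))) , ∈-++⁺ʳ _ (here refl)

  ψ-guarded : ∀ {i} → i < m → (x⁻ i ∷ C i) ∈ ψ
  ψ-guarded i<m = ∈-++⁺ʳ _ (there (∈-map⁺ _ (∈-upTo⁺ i<m)))

  φ-clause : ∀ {i} → i < m → C i ∈ φ
  φ-clause i<m = ∈-map⁺ C (∈-upTo⁺ i<m)

  data φ-Clause : Clause → Set where
    clause : ∀ {i} → i < m → φ-Clause (C i)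

  φ-clause⁻ : ∀ {D} → D ∈ φ → φ-Clause D
  φ-clause⁻ D∈φ with i , i∈ , refl ← ∈-map⁻ C D∈φ = clause (∈-upTo⁻ i∈)

  data ψ-Clause : Clause → Set where
    step : ∀ {i} → i < m ∸ 1 → ψ-Clause (step-clause i)
    wrap : ψ-Clause wrap-clause
    guarded : ∀ {i} → i < m → ψ-Clause (x⁻ i ∷ C i)

  ψ-clause⁻ : ∀ {D} → D ∈ ψ → ψ-Clause D
  ψ-clause⁻ D∈ψ with ∈-++⁻ (map step-clause (upTo (m ∸ 1))) D∈ψ
  ... | inj₁ D∈steps with i , i∈ , refl ← ∈-map⁻ step-clause D∈steps = step (∈-upTo⁻ i∈)
  ... | inj₂ (here refl) = wrap
  ... | inj₂ (there D∈guarded) with i , i∈ , refl ← ∈-map⁻ (λ i → x⁻ i ∷ C i) D∈guarded = guarded (∈-upTo⁻ i∈)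

  IsX : ℕ → Set
  IsX y = ∃ λ k → k < m × x k ≡ y

  isX? : Decidable IsX
  isX? y = ∃<? m (λ k → x k ≟ y)

  x-free? : (l : Lit) → Dec (¬ IsX (var l))
  x-free? l = ¬? (isX? (var l))

  XFree : Clause → Set
  XFree D = ∀ {l} → l ∈ D → ¬ IsX (var l)

  x-literal : ∀ {d} → IsX (var d) → ∃ λ k → k < m × (d ≡ x⁺ k ⊎ d ≡ x⁻ k)
  x-literal {pos _} (k , k<m , refl) = k , k<m , inj₁ refl
  x-literal {neg _} (k , k<m , refl) = k , k<m , inj₂ refl

  φ-x-free : ∀ {y} → OccursIn y φ → ¬ IsX y
  φ-x-free occ (k , k<m , refl) = x-fresh k k<m occ

  setX : Bool → Assignment → Assignment
  setX = override isX?

  setX-x : ∀ b v {k} → k < m → setX b v (x k) ≡ b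
  setX-x b v k<m = override-inside isX? b v (_ , k<m , refl)

  setX-x-free : ∀ b v {l} → ¬ IsX (var l) → evalLit (setX b v) l ≡ evalLit v l
  setX-x-free b v {l} ¬x = evalLit-cong l (override-outside isX? b v ¬x)

  setX-φ : ∀ b {v} → Sat v φ → Sat (setX b v) φ
  setX-φ b {v} = Sat-cong φ (λ y occ → sym (override-outside isX? b v (φ-x-free occ)))

  Sat-ψ-if-x-false : ∀ v → (∀ {k} → k < m → v (x k) ≡ false) → Sat v ψ
  Sat-ψ-if-x-false v x-false = All.tabulate (satisfied ∘′ ψ-clause⁻)
    where
    satisfied : ∀ {D} → ψ-Clause D → SatC v D
    satisfied (step i<m-1) = here (cong not (x-false (<pred⇒< i<m-1)))
    satisfied wrap = here (cong not (x-false (pred< 0<m)))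
    satisfied (guarded i<m) = here (cong not (x-false i<m))

  Sat-ψ-lift : ∀ {v} → Sat v φ → Sat (setX true v) ψ
  Sat-ψ-lift {v} sφ = All.tabulate (satisfied ∘′ ψ-clause⁻)
    where
    satisfied : ∀ {D} → ψ-Clause D → SatC (setX true v) D
    satisfied (step i<m-1) = there (here (setX-x true v (<pred⇒suc< i<m-1)))
    satisfied wrap = there (here (setX-x true v 0<m))
    satisfied (guarded i<m) = there (All.lookup (setX-φ true sφ) (φ-clause i<m))

  Sat-ψ⇒Sat-φ : ∀ {v} → Sat v ψ → ∀ {a} → a < m → v (x a) ≡ true → Sat v φ
  Sat-ψ⇒Sat-φ {v} sψ a<m xa = All.tabulate (satisfied ∘′ φ-clause⁻)
    where
    satisfied : ∀ {D} → φ-Clause D → SatC v D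
    satisfied (clause i<m) with All.lookup sψ (ψ-guarded i<m)
    ... | here ¬xi with () ← trans (sym ¬xi) (cong not (cycle-true ψ-cycle sψ a<m xa i<m))
    ... | there sCi = sCi

  prime-x-free : ∀ {E} → PrimeImplicate φ E → XFree E
  prime-x-free pE l∈E = φ-x-free (prime-implicate-var-occurs pE l∈E)

  prime-in-L : ∀ {D} → φ ⊨ D → NonTaut D → ∃ λ E → E ∈ L × E ⊆C D
  prime-in-L {D} φ⊨D ntD = find (decidable-stable (Any.any? (_⊆? D) L) λ none →
    prime-implicate-⊆ φ⊨D ntD λ (Q , pQ , Q⊆D) →
      none (Any.map (λ (_ , E⊆Q) {e} e∈E → Q⊆D (E⊆Q e∈E)) (L-complete Q pQ)))

  Sat-ψ-model : ∀ {α} → (∀ {k} → k < m → x⁺ k ∉ α) → Sat (model α) ψ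
  Sat-ψ-model no-x⁺ = Sat-ψ-if-x-false _ λ k<m → model-false _ (no-x⁺ k<m)

  ψ⊭-without-x⁻ : ∀ {D} → NonTaut D → (∀ {k} → k < m → x⁻ k ∉ D) → ¬ (ψ ⊨ D)
  ψ⊭-without-x⁻ {D} ntD no-x⁻ ψ⊨D
    with l , l∈D , lt ← find (ψ⊨D _ (Sat-ψ-model (λ k<m → no-x⁻ k<m ∘′ ∈-map-compl⁻)))
    with () ← trans (sym lt) (falsifier-falsifies ntD l∈D)

  φ⊨x-free-part : ∀ {D} → ψ ⊨ D → (∀ {k} → k < m → x⁺ k ∉ D) → φ ⊨ filter x-free? D
  φ⊨x-free-part {D} ψ⊨D no-x⁺ v sφ
    with d , d∈D , dt ← find (ψ⊨D (setX true v) (Sat-ψ-lift sφ))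
    with isX? (var d)
  ... | no ¬x = lose (∈-filter⁺ x-free? d∈D ¬x) (trans (sym (setX-x-free true v {d} ¬x)) dt)
  ... | yes isx with x-literal {d} isx
  ...   | k , k<m , inj₁ refl = contradiction d∈D (no-x⁺ k<m)
  ...   | k , k<m , inj₂ refl with () ← trans (sym dt) (cong not (setX-x true v k<m))

  unforced : ∀ {H α u} → (∀ v → Sat v ψ → Sat v H) → Consistent α → u ∉ α →
    (∀ {k} → k < m → x⁺ k ∉ compl u ∷ α) → ¬ ((H ++ units α) ⊨ (u ∷ []))
  unforced {H} {α} {u} ψ⇒H cons u∉α no-x⁺ H,α⊨u =
    ¬both-true w u (singleton⁻ (H,α⊨u w (All.++⁺ (ψ⇒H w (Sat-ψ-model no-x⁺)) (Sat-units⁺ α (w⊨ ∘′ there)))))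
      (w⊨ (here refl))
    where
    w : Assignment
    w = model (compl u ∷ α)
    w⊨ : ∀ {a} → a ∈ compl u ∷ α → evalLit w a ≡ true
    w⊨ = model-satisfies (Consistent-∷-compl cons u∉α)

  forced-literal : ∀ {H α u} → (∀ v → Sat v ψ → Sat v H) → Consistent α → (∀ {k} → k < m → x⁺ k ∉ α) →
    (H ++ units α) ⊨ (u ∷ []) → u ∈ α ⊎ ∃ λ k → k < m × u ≡ x⁻ k
  forced-literal {H} {α} {u} ψ⇒H cons no-x⁺ H,α⊨u with u ∈? α | ∃<? m (λ k → u ≟L x⁻ k)
  ... | yes u∈α | _ = inj₁ u∈α
  ... | no _ | yes u-neg = inj₂ u-neg
  ... | no u∉α | no ¬u-neg = ⊥-elim (unforced ψ⇒H cons u∉α no-x⁺′ H,α⊨u)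
    where
    no-x⁺′ : ∀ {k} → k < m → x⁺ k ∉ compl u ∷ α
    no-x⁺′ k<m (here eq) = ¬u-neg (_ , k<m , compl-injective (sym eq))
    no-x⁺′ k<m (there x⁺k∈α) = no-x⁺ k<m x⁺k∈α

  ψ⊨x⁻∷E : ∀ {i E} → i < m → φ ⊨ E → ψ ⊨ (x⁻ i ∷ E)
  ψ⊨x⁻∷E {i} i<m φ⊨E v sψ with v (x i) in xi
  ... | false = here (cong not xi)
  ... | true = there (φ⊨E v (Sat-ψ⇒Sat-φ sψ i<m xi))

  ψ⊨x⁻∷x⁺ : ∀ {i j} → i < m → j < m → ψ ⊨ (x⁻ i ∷ x⁺ j ∷ [])
  ψ⊨x⁻∷x⁺ {i} i<m j<m v sψ with v (x i) in xi
  ... | false = here (cong not xi)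
  ... | true = there (here (cycle-true ψ-cycle sψ i<m xi j<m))

  ψ⊨⊆x⁻∷E⇒⊇ : ∀ {k E D} → k < m → PrimeImplicate φ E → D ⊆C (x⁻ k ∷ E) → ψ ⊨ D → (x⁻ k ∷ E) ⊆C D
  ψ⊨⊆x⁻∷E⇒⊇ {k} {E} {D} k<m pE@(ntE , _ , _) D⊆ ψ⊨D (here refl) =
    decidable-stable (x⁻ k ∈? D) λ x⁻k∉D →
      ψ⊭-without-x⁻ (NonTaut-⊆ (D⊆E x⁻k∉D) ntE) (λ j<m x⁻j∈D → prime-x-free pE (D⊆E x⁻k∉D x⁻j∈D) (_ , j<m , refl)) ψ⊨D
    where
    D⊆E : x⁻ k ∉ D → D ⊆C E
    D⊆E x⁻k∉D d∈D with D⊆ d∈D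
    ... | here refl = contradiction d∈D x⁻k∉D
    ... | there d∈E = d∈E
  ψ⊨⊆x⁻∷E⇒⊇ {k} {E} {D} k<m pE D⊆ ψ⊨D (there e∈E) =
    proj₁ (∈-filter⁻ x-free? (prime-implicate-minimal pE D′⊆E (φ⊨x-free-part ψ⊨D no-x⁺) e∈E))
    where
    D′⊆E : filter x-free? D ⊆C E
    D′⊆E d∈D′ with d∈D , ¬x ← ∈-filter⁻ x-free? d∈D′ with D⊆ d∈D
    ... | here refl = contradiction (k , k<m , refl) ¬x
    ... | there d∈E = d∈E
    no-x⁺ : ∀ {j} → j < m → x⁺ j ∉ D
    no-x⁺ j<m x⁺j∈D with D⊆ x⁺j∈D
    ... | there x⁺j∈E = prime-x-free pE x⁺j∈E (_ , j<m , refl)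

  ψ-prime-x⁻∷E : ∀ {k E} → k < m → PrimeImplicate φ E → PrimeImplicate ψ (x⁻ k ∷ E)
  ψ-prime-x⁻∷E k<m pE@(ntE , φ⊨E , _) =
    NonTaut-∷ (λ x⁺k∈E → prime-x-free pE x⁺k∈E (_ , k<m , refl)) ntE ,
    ψ⊨x⁻∷E k<m φ⊨E ,
    λ D D⊆ ⊉ ψ⊨D → ⊉ (ψ⊨⊆x⁻∷E⇒⊇ k<m pE D⊆ ψ⊨D)

  ψ-prime-x⁻∷x⁺ : ∀ {i j} → i < m → j < m → i ≢ j → PrimeImplicate ψ (x⁻ i ∷ x⁺ j ∷ [])
  ψ-prime-x⁻∷x⁺ {i} {j} i<m j<m i≢j =
    NonTaut-∷ (λ { (here eq) → i≢j (x-injective i j i<m j<m (cong var eq)) }) (λ { (here refl) (here ()) }) ,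
    ψ⊨x⁻∷x⁺ i<m j<m ,
    λ D D⊆ ⊉ ψ⊨D → ⊉ λ { (here refl) → x⁻i∈ D⊆ ψ⊨D ; (there (here refl)) → x⁺j∈ D⊆ ψ⊨D }
    where
    all-x : ∀ {d} → d ∈ x⁻ i ∷ x⁺ j ∷ [] → IsX (var d)
    all-x (here refl) = i , i<m , refl
    all-x (there (here refl)) = j , j<m , refl
    x⁻i∈ : ∀ {D} → D ⊆C (x⁻ i ∷ x⁺ j ∷ []) → ψ ⊨ D → x⁻ i ∈ D
    x⁻i∈ {D} D⊆ ψ⊨D = decidable-stable (x⁻ i ∈? D) λ x⁻i∉D →
      ψ⊭-without-x⁻ (NonTaut-⊆ (D⊆x⁺j x⁻i∉D) (λ { (here refl) (here ()) }))
        (λ _ x⁻k∈D → case D⊆x⁺j x⁻i∉D x⁻k∈D of λ { (here ()) }) ψ⊨D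
      where
      D⊆x⁺j : x⁻ i ∉ D → D ⊆C (x⁺ j ∷ [])
      D⊆x⁺j x⁻i∉D d∈D with D⊆ d∈D
      ... | here refl = contradiction d∈D x⁻i∉D
      ... | there d∈ = d∈
    x⁺j∈ : ∀ {D} → D ⊆C (x⁻ i ∷ x⁺ j ∷ []) → ψ ⊨ D → x⁺ j ∈ D
    x⁺j∈ {D} D⊆ ψ⊨D = decidable-stable (x⁺ j ∈? D) λ x⁺j∉D →
      let v , sφ = φ-satisfiable
          d , d∈D′ , _ = find (φ⊨x-free-part ψ⊨D (no-x⁺ x⁺j∉D) v sφ)
          d∈D , ¬x = ∈-filter⁻ x-free? d∈D′
      in ¬x (all-x (D⊆ d∈D))
      where
      no-x⁺ : x⁺ j ∉ D → ∀ {k} → k < m → x⁺ k ∉ D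
      no-x⁺ x⁺j∉D _ x⁺k∈D with D⊆ x⁺k∈D
      ... | there (here eq) = x⁺j∉D (subst (_∈ D) eq x⁺k∈D)

  L-prime-at : ∀ {E} → E ∈ L → PrimeImplicate φ E
  L-prime-at = All.lookup L-prime

  drop-x⁻ : ∀ {i k E E′} → k < m → XFree E → (x⁻ i ∷ E) ⊆C (x⁻ k ∷ E′) → E ⊆C E′
  drop-x⁻ {k = k} k<m x-free E⊆ e∈E with E⊆ (there e∈E)
  ... | here refl = contradiction (k , k<m , refl) (x-free e∈E)
  ... | there e∈E′ = e∈E′

  others : ℕ → List ℕ
  others i = filter (λ j → ¬? (j ≟ i)) (upTo m)

  length-others : ∀ {i} → i < m → length (others i) ≡ m ∸ 1
  length-others i<m = cong pred (trans (length-filter-≢ _≟_ (upTo⁺ m) (∈-upTo⁺ i<m)) (length-upTo m))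

  implicates-with : ℕ → List Clause
  implicates-with i = map (x⁻ i ∷_) L ++ map (λ j → x⁻ i ∷ x⁺ j ∷ []) (others i)

  Lψ : List Clause
  Lψ = concatMap implicates-with (upTo m)

  length-Lψ : length Lψ ≡ m * length L + m * (m ∸ 1)
  length-Lψ = begin
    length Lψ                               ≡⟨ length-concatMap implicates-with (upTo m) length-block ⟩
    length (upTo m) * (length L + (m ∸ 1))  ≡⟨ cong (_* (length L + (m ∸ 1))) (length-upTo m) ⟩
    m * (length L + (m ∸ 1))                ≡⟨ *-distribˡ-+ m (length L) (m ∸ 1) ⟩
    m * length L + m * (m ∸ 1)              ∎
    where
    open ≡-Reasoning
    length-block : ∀ {i} → i ∈ upTo m → length (implicates-with i) ≡ length L + (m ∸ 1)
    length-block {i} i∈ = trans (length-++ (map (x⁻ i ∷_) L))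
      (cong₂ _+_ (length-map _ L) (trans (length-map _ (others i)) (length-others (∈-upTo⁻ i∈))))

  data Lψ-Clause (i : ℕ) : Clause → Set where
    with-prime : ∀ {E} → E ∈ L → Lψ-Clause i (x⁻ i ∷ E)
    with-x⁺ : ∀ {j} → j < m → i ≢ j → Lψ-Clause i (x⁻ i ∷ x⁺ j ∷ [])

  implicates-with⁻ : ∀ {i D} → D ∈ implicates-with i → Lψ-Clause i D
  implicates-with⁻ {i} D∈ with ∈-++⁻ (map (x⁻ i ∷_) L) D∈
  ... | inj₁ D∈A with E , E∈L , refl ← ∈-map⁻ (x⁻ i ∷_) D∈A = with-prime E∈L
  ... | inj₂ D∈B with j , j∈others , refl ← ∈-map⁻ (λ j → x⁻ i ∷ x⁺ j ∷ []) D∈B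
                 with j∈upTo , j≢i ← ∈-filter⁻ (λ j → ¬? (j ≟ i)) {xs = upTo m} j∈others =
    with-x⁺ (∈-upTo⁻ j∈upTo) (j≢i ∘′ sym)

  Lψ⁻ : ∀ {D} → D ∈ Lψ → ∃ λ i → i < m × Lψ-Clause i D
  Lψ⁻ D∈ with i , i∈ , D∈i ← find (∈-concatMap⁻ implicates-with D∈) = i , ∈-upTo⁻ i∈ , implicates-with⁻ D∈i

  ∈Lψ-x⁻∷E : ∀ {i E} → i < m → E ∈ L → (x⁻ i ∷ E) ∈ Lψ
  ∈Lψ-x⁻∷E i<m E∈L = ∈-concatMap⁺ implicates-with (lose (∈-upTo⁺ i<m) (∈-++⁺ˡ (∈-map⁺ _ E∈L)))

  ∈Lψ-x⁻∷x⁺ : ∀ {i j} → i < m → j < m → i ≢ j → (x⁻ i ∷ x⁺ j ∷ []) ∈ Lψ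
  ∈Lψ-x⁻∷x⁺ i<m j<m i≢j = ∈-concatMap⁺ implicates-with (lose (∈-upTo⁺ i<m)
    (∈-++⁺ʳ _ (∈-map⁺ _ (∈-filter⁺ (λ j → ¬? (j ≟ _)) (∈-upTo⁺ j<m) (i≢j ∘′ sym)))))

  Lψ-prime : All (PrimeImplicate ψ) Lψ
  Lψ-prime = All.tabulate λ D∈ → let _ , i<m , D-shape = Lψ⁻ D∈ in prime i<m D-shape
    where
    prime : ∀ {i D} → i < m → Lψ-Clause i D → PrimeImplicate ψ D
    prime i<m (with-prime E∈L) = ψ-prime-x⁻∷E i<m (L-prime-at E∈L)
    prime i<m (with-x⁺ j<m i≢j) = ψ-prime-x⁻∷x⁺ i<m j<m i≢j

  Lψ-complete : ∀ D → PrimeImplicate ψ D → Any (D ≈C_) Lψ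
  Lψ-complete D pD@(ntD , ψ⊨D , _) with ∃<? m (λ k → x⁻ k ∈? D)
  ... | no ∄x⁻ = ⊥-elim (ψ⊭-without-x⁻ ntD (λ k<m x⁻k∈D → ∄x⁻ (_ , k<m , x⁻k∈D)) ψ⊨D)
  ... | yes (i , i<m , x⁻i∈D) with ∃<? m (λ j → x⁺ j ∈? D)
  ...   | yes (j , j<m , x⁺j∈D) =
    lose (∈Lψ-x⁻∷x⁺ i<m j<m (λ { refl → ntD x⁻i∈D x⁺j∈D }))
      (prime-implicate-minimal pD K⊆D (ψ⊨x⁻∷x⁺ i<m j<m) , K⊆D)
    where
    K⊆D : (x⁻ i ∷ x⁺ j ∷ []) ⊆C D
    K⊆D (here refl) = x⁻i∈D
    K⊆D (there (here refl)) = x⁺j∈D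
  ...   | no ∄x⁺
    with E , E∈L , E⊆D′ ← prime-in-L (φ⊨x-free-part ψ⊨D λ k<m x⁺k∈D → ∄x⁺ (_ , k<m , x⁺k∈D))
                                      (NonTaut-⊆ (proj₁ ∘′ ∈-filter⁻ x-free?) ntD) =
    lose (∈Lψ-x⁻∷E i<m E∈L) (prime-implicate-minimal pD K⊆D (ψ⊨x⁻∷E i<m (proj₁ (proj₂ (L-prime-at E∈L)))) , K⊆D)
    where
    K⊆D : (x⁻ i ∷ E) ⊆C D
    K⊆D (here refl) = x⁻i∈D
    K⊆D (there e∈E) = proj₁ (∈-filter⁻ x-free? (E⊆D′ e∈E))

  L-x-free : ∀ {E} → E ∈ L → XFree E
  L-x-free = prime-x-free ∘′ L-prime-at

  head-x⁻ : ∀ {i D} → Lψ-Clause i D → x⁻ i ∈ D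
  head-x⁻ (with-prime _) = here refl
  head-x⁻ (with-x⁺ _ _) = here refl

  only-x⁻ : ∀ {i D} → i < m → Lψ-Clause i D → ∀ {k} → k < m → x⁻ k ∈ D → k ≡ i
  only-x⁻ i<m (with-prime _) k<m (here eq) = x-injective _ _ k<m i<m (cong var eq)
  only-x⁻ i<m (with-prime E∈L) k<m (there x⁻k∈E) = contradiction (_ , k<m , refl) (L-x-free E∈L x⁻k∈E)
  only-x⁻ i<m (with-x⁺ _ _) k<m (here eq) = x-injective _ _ k<m i<m (cong var eq)
  only-x⁻ i<m (with-x⁺ _ _) k<m (there (here ()))

  Lψ-distinct : AllPairs (λ D D′ → ¬ (D ≈C D′)) Lψ
  Lψ-distinct = concatMap-AllPairs implicates-with (upTo⁺ m) (block-distinct ∘′ ∈-upTo⁻) across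
    where
    block-distinct : ∀ {i} → i < m → AllPairs (λ D D′ → ¬ (D ≈C D′)) (implicates-with i)
    block-distinct {i} i<m = AllPairs.++⁺
      (map-AllPairs (x⁻ i ∷_) (λ E∈ E′∈ E≉E′ (⊆ , ⊇) →
          E≉E′ (drop-x⁻ i<m (L-x-free E∈) ⊆ , drop-x⁻ i<m (L-x-free E′∈) ⊇)) L-distinct)
      (map-AllPairs (λ j → x⁻ i ∷ x⁺ j ∷ []) (λ j∈ j′∈ j≢j′ (⊆ , _) → j≢j′ (same-x⁺ j∈ j′∈ (⊆ (there (here refl)))))
        (Unique-filter⁺ _ (upTo⁺ m)))
      (All.tabulate λ D∈ → All.tabulate λ D′∈ → prime≉x⁺ D∈ D′∈)
      where
      prime≉x⁺ : ∀ {D D′} → D ∈ map (x⁻ i ∷_) L → D′ ∈ map (λ j → x⁻ i ∷ x⁺ j ∷ []) (others i) → ¬ (D ≈C D′)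
      prime≉x⁺ D∈ D′∈ (_ , ⊇)
        with E , E∈L , refl ← ∈-map⁻ (x⁻ i ∷_) D∈
           | j , j∈ , refl ← ∈-map⁻ (λ j → x⁻ i ∷ x⁺ j ∷ []) D′∈
        with ⊇ (there (here refl))
      ... | there x⁺j∈E = L-x-free E∈L x⁺j∈E (j , ∈-upTo⁻ (proj₁ (∈-filter⁻ _ j∈)) , refl)
      same-x⁺ : ∀ {j j′} → j ∈ others i → j′ ∈ others i → x⁺ j ∈ x⁻ i ∷ x⁺ j′ ∷ [] → j ≡ j′
      same-x⁺ j∈ j′∈ (there (here eq)) = x-injective _ _ (∈-upTo⁻ (proj₁ (∈-filter⁻ _ j∈))) (∈-upTo⁻ (proj₁ (∈-filter⁻ _ j′∈))) (cong var eq)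
    across : ∀ {i i′ D D′} → i ∈ upTo m → i′ ∈ upTo m → i ≢ i′ → D ∈ implicates-with i → D′ ∈ implicates-with i′ → ¬ (D ≈C D′)
    across i∈ i′∈ i≢i′ D∈ D′∈ (⊆ , _) = i≢i′ (only-x⁻ (∈-upTo⁻ i′∈) (implicates-with⁻ D′∈) (∈-upTo⁻ i∈) (⊆ (head-x⁻ (implicates-with⁻ D∈))))
    

  ψ-prime-count : NumPrimeImplicates ψ (m * length L + m * (m ∸ 1))
  ψ-prime-count = Lψ , length-Lψ , Lψ-prime , Lψ-complete , Lψ-distinct

  Sat-φ-if-L : ∀ {v} → (∀ {E} → E ∈ L → SatC v E) → Sat v φ
  Sat-φ-if-L {v} sL = All.tabulate satisfied
    where
    satisfied : ∀ {D} → D ∈ φ → SatC v D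
    satisfied {D} D∈φ with tautology? D
    ... | inj₁ (l , l∈D , l̅∈D) = SatC-tautology v l∈D l̅∈D
    ... | inj₂ ntD with E , E∈L , E⊆D ← prime-in-L (λ w sφ → All.lookup sφ D∈φ) ntD = SatC-⊆ E⊆D (sL E∈L)

  φ-vars⊆ψ-vars : ∀ {y} → OccursIn y φ → OccursIn y ψ
  φ-vars⊆ψ-vars occ with D , D∈φ , occD ← find occ with φ-clause⁻ D∈φ
  ... | clause i<m = lose (ψ-guarded i<m) (there occD)

  cycle-clauses : CNF
  cycle-clauses = map step-clause (upTo (m ∸ 1)) ++ wrap-clause ∷ []

  G : CNF
  G = map (x⁻ 0 ∷_) L ++ cycle-clauses

  length-G : length G ≡ length L + m
  length-G = begin
    length G                                                ≡⟨ length-++ (map (x⁻ 0 ∷_) L) ⟩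
    length (map (x⁻ 0 ∷_) L) + length cycle-clauses         ≡⟨ cong₂ _+_ (length-map _ L) (length-++ (map step-clause (upTo (m ∸ 1)))) ⟩
    length L + (length (map step-clause (upTo (m ∸ 1))) + 1) ≡⟨ cong (λ n → length L + (n + 1)) (trans (length-map _ (upTo (m ∸ 1))) (length-upTo (m ∸ 1))) ⟩
    length L + (m ∸ 1 + 1)                                  ≡⟨ cong (length L +_) (m∸n+n≡m 0<m) ⟩
    length L + m                                            ∎
    where open ≡-Reasoning

  G-cycle : CycleIn G
  G-cycle = (λ i<m-1 → ∈-++⁺ʳ guards (∈-++⁺ˡ (∈-map⁺ step-clause (∈-upTo⁺ i<m-1))))
          , ∈-++⁺ʳ guards (∈-++⁺ʳ (map step-clause (upTo (m ∸ 1))) (here refl))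
    where
    guards = map (x⁻ 0 ∷_) L

  data G-Clause : Clause → Set where
    guard : ∀ {E} → E ∈ L → G-Clause (x⁻ 0 ∷ E)
    step : ∀ {i} → i < m ∸ 1 → G-Clause (step-clause i)
    wrap : G-Clause wrap-clause

  G-clause⁻ : ∀ {D} → D ∈ G → G-Clause D
  G-clause⁻ D∈G with ∈-++⁻ (map (x⁻ 0 ∷_) L) D∈G
  ... | inj₁ D∈guards with E , E∈L , refl ← ∈-map⁻ (x⁻ 0 ∷_) D∈guards = guard E∈L
  ... | inj₂ D∈cycle with ∈-++⁻ (map step-clause (upTo (m ∸ 1))) D∈cycle
  ...   | inj₁ D∈steps with i , i∈ , refl ← ∈-map⁻ step-clause D∈steps = step (∈-upTo⁻ i∈)
  ...   | inj₂ (here refl) = wrap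

  guard∈G : ∀ {E} → E ∈ L → (x⁻ 0 ∷ E) ∈ G
  guard∈G E∈L = ∈-++⁺ˡ (∈-map⁺ (x⁻ 0 ∷_) E∈L)

  ψ⇒G : ∀ v → Sat v ψ → Sat v G
  ψ⇒G v sψ = All.tabulate (satisfied ∘′ G-clause⁻)
    where
    satisfied : ∀ {D} → G-Clause D → SatC v D
    satisfied (guard E∈L) = ψ⊨x⁻∷E 0<m (proj₁ (proj₂ (L-prime-at E∈L))) v sψ
    satisfied (step i<m-1) = All.lookup sψ (proj₁ ψ-cycle i<m-1)
    satisfied wrap = All.lookup sψ (proj₂ ψ-cycle)

  G⇒ψ : ∀ v → Sat v G → Sat v ψ
  G⇒ψ v sG = All.tabulate (satisfied ∘′ ψ-clause⁻)
    where
    satisfied : ∀ {D} → ψ-Clause D → SatC v D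
    satisfied (step i<m-1) = All.lookup sG (proj₁ G-cycle i<m-1)
    satisfied wrap = All.lookup sG (proj₂ G-cycle)
    satisfied (guarded {i} i<m) with v (x i) in xi
    ... | false = here (cong not xi)
    ... | true = there (All.lookup (Sat-φ-if-L L-satisfied) (φ-clause i<m))
      where
      L-satisfied : ∀ {E} → E ∈ L → SatC v E
      L-satisfied E∈L with All.lookup sG (guard∈G E∈L)
      ... | here ¬x0 with () ← trans (sym ¬x0) (cong not (cycle-true G-cycle sG i<m xi 0<m))
      ... | there sE = sE

  G-vars⊆ψ-vars : ∀ y → OccursIn y G → OccursIn y ψ
  G-vars⊆ψ-vars y occ with D , D∈G , occD ← find occ with G-clause⁻ D∈G
  ... | step i<m-1 = lose (proj₁ ψ-cycle i<m-1) occD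
  ... | wrap = lose (proj₂ ψ-cycle) occD
  ... | guard E∈L with occD
  ...   | here x0≡y = lose (ψ-guarded 0<m) (here x0≡y)
  ...   | there occE with l , l∈E , refl ← find occE =
    φ-vars⊆ψ-vars (prime-implicate-var-occurs (L-prime-at E∈L) l∈E)

  module G-propagation {α : List Lit} (cons : Consistent α) where

    F : CNF
    F = G ++ units α

    α-axiom : ∀ {a} → a ∈ α → F ⊢₁lit a
    α-axiom a∈α = ⊢₁lit-axiom (∈-++⁺ʳ G (∈-map⁺ (_∷ []) a∈α))

    ⊢compl-α̅ : ∀ {s} → s ∈ map compl α → F ⊢₁lit compl s
    ⊢compl-α̅ s∈ with a , a∈α , refl ← ∈-map⁻ compl s∈ = subst (F ⊢₁lit_) (sym (compl-involutive a)) (α-axiom a∈α)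

    guard∈F : ∀ {E} → E ∈ L → (x⁻ 0 ∷ E) ∈ F
    guard∈F = ∈-++⁺ˡ ∘′ guard∈G

    all-x⁺ : ∀ {a} → a < m → x⁺ a ∈ α → ∀ {j} → j < m → F ⊢₁lit x⁺ j
    all-x⁺ a<m x⁺a∈α = cycle-⊢₁pos G-cycle ∈-++⁺ˡ a<m (α-axiom x⁺a∈α)

    all-x⁻ : ∀ {b} → b < m → F ⊢₁lit x⁻ b → ∀ {j} → j < m → F ⊢₁lit x⁻ j
    all-x⁻ = cycle-⊢₁neg G-cycle ∈-++⁺ˡ

    prime-below-query : ∀ {l} → F ⊨ (l ∷ []) → l ∉ α → (∀ {k} → k < m → x⁺ k ∉ l ∷ map compl α) →
      ∃ λ E → E ∈ L × E ⊆C (l ∷ map compl α)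
    prime-below-query {l} F⊨l l∉α no-x⁺ =
      let E , E∈L , E⊆ = prime-in-L (φ⊨x-free-part ψ⊨query no-x⁺) (NonTaut-⊆ (proj₁ ∘′ ∈-filter⁻ x-free?) nt-query)
      in E , E∈L , proj₁ ∘′ ∈-filter⁻ x-free? ∘′ E⊆
      where
      ψ⊨query : ψ ⊨ (l ∷ map compl α)
      ψ⊨query v sψ = ⊨-units⇒⊨-compl α F⊨l v (ψ⇒G v sψ)
      nt-query : NonTaut (l ∷ map compl α)
      nt-query = NonTaut-∷ (l∉α ∘′ ∈-map-compl⁻) (NonTaut-map-compl cons)

    no-x⁺-query : ∀ {l} → (∀ {k} → k < m → l ≢ x⁺ k) → (∀ {k} → k < m → x⁻ k ∉ α) →
      ∀ {k} → k < m → x⁺ k ∉ l ∷ map compl α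
    no-x⁺-query l≢x⁺ _ k<m (here x⁺k≡l) = l≢x⁺ k<m (sym x⁺k≡l)
    no-x⁺-query _ no-x⁻ k<m (there x⁺k∈α̅) = no-x⁻ k<m (∈-map-compl⁻ x⁺k∈α̅)

    propagate-with-x⁺ : ∀ {l a} → F ⊨ (l ∷ []) → a < m → x⁺ a ∈ α → l ∉ α → F ⊢₁lit l ⊎ F ⊢₁⊥
    propagate-with-x⁺ {l} F⊨l a<m x⁺a∈α l∉α with ∃<? m (λ b → x⁻ b ∈? α) | ∃<? m (λ j → l ≟L x⁺ j)
    ... | yes (b , b<m , x⁻b∈α) | _ = inj₂ (⊢₁-clash (all-x⁺ a<m x⁺a∈α b<m) (α-axiom x⁻b∈α))
    ... | no _ | yes (j , j<m , refl) = inj₁ (all-x⁺ a<m x⁺a∈α j<m)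
    ... | no ∄x⁻ | no ∄j
      with E , E∈L , E⊆ ← prime-below-query F⊨l l∉α
             (no-x⁺-query (λ k<m l≡x⁺k → ∄j (_ , k<m , l≡x⁺k)) λ k<m x⁻k∈α → ∄x⁻ (_ , k<m , x⁻k∈α)) =
      resolve-to-unit l (axiom (guard∈F E∈L)) (x⁻ 0 ∷ map compl α) ⊢S̅ covered
      where
      ⊢S̅ : ∀ {s} → s ∈ x⁻ 0 ∷ map compl α → F ⊢₁lit compl s
      ⊢S̅ (here refl) = all-x⁺ a<m x⁺a∈α 0<m
      ⊢S̅ (there s∈α̅) = ⊢compl-α̅ s∈α̅
      covered : ∀ {k} → k ∈ x⁻ 0 ∷ E → k ∈ x⁻ 0 ∷ map compl α ⊎ k ≡ l
      covered (here refl) = inj₁ (here refl)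
      covered (there k∈E) with E⊆ k∈E
      ... | here refl = inj₂ refl
      ... | there k∈α̅ = inj₁ (there k∈α̅)

    propagate-without-x⁺ : ∀ {l} → F ⊨ (l ∷ []) → (∀ {a} → a < m → x⁺ a ∉ α) → l ∉ α → F ⊢₁lit l ⊎ F ⊢₁⊥
    propagate-without-x⁺ F⊨l ∄x⁺ l∉α with forced-literal ψ⇒G cons ∄x⁺ F⊨l
    ... | inj₁ l∈α = contradiction l∈α l∉α
    ... | inj₂ (j , j<m , refl) with ∃<? m (λ b → x⁻ b ∈? α)
    ...   | yes (b , b<m , x⁻b∈α) = inj₁ (all-x⁻ b<m (α-axiom x⁻b∈α) j<m)
    ...   | no ∄x⁻ with E , E∈L , E⊆ ← prime-below-query F⊨l l∉α
                                          (no-x⁺-query (λ _ ()) λ k<m x⁻k∈α → ∄x⁻ (_ , k<m , x⁻k∈α)) =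
      Sum.map₁ (λ ⊢x⁻0 → all-x⁻ 0<m ⊢x⁻0 j<m)
        (resolve-to-unit (x⁻ 0) (axiom (guard∈F E∈L)) (map compl α) ⊢compl-α̅ covered)
      where
      covered : ∀ {k} → k ∈ x⁻ 0 ∷ E → k ∈ map compl α ⊎ k ≡ x⁻ 0
      covered (here refl) = inj₂ refl
      covered (there k∈E) with E⊆ k∈E
      ... | here refl = contradiction (j , j<m , refl) (L-x-free E∈L k∈E)
      ... | there k∈α̅ = inj₁ k∈α̅

    propagate : ∀ {l} → F ⊨ (l ∷ []) → F ⊢₁lit l ⊎ F ⊢₁⊥
    propagate {l} F⊨l with l ∈? α | ∃<? m (λ a → x⁺ a ∈? α)
    ... | yes l∈α | _ = inj₁ (α-axiom l∈α)
    ... | no l∉α | yes (a , a<m , x⁺a∈α) = propagate-with-x⁺ F⊨l a<m x⁺a∈α l∉α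
    ... | no l∉α | no ∄x⁺ = propagate-without-x⁺ F⊨l (λ a<m x⁺a∈α → ∄x⁺ (_ , a<m , x⁺a∈α)) l∉α

  G-PC : PCRepresentation ψ G
  G-PC = (λ v → ψ⇒G v , G⇒ψ v) , G-vars⊆ψ-vars , λ α cons l → G-propagation.propagate cons

  other-index : ∀ {j} → j < m → ∃ λ a → a < m × a ≢ j
  other-index {zero} _ = 1 , 2≤m , λ ()
  other-index {suc _} _ = 0 , 0<m , λ ()

  module Lower-bound {H : CNF} (H-PC : PCRepresentation ψ H) where

    ψ⇒H : ∀ v → Sat v ψ → Sat v H
    ψ⇒H v = proj₁ (proj₁ H-PC v)

    H⇒ψ : ∀ v → Sat v H → Sat v ψ
    H⇒ψ v = proj₂ (proj₁ H-PC v)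

    H-propagates : PropagationComplete H
    H-propagates = proj₂ (proj₂ H-PC)

    ψ⊨H-clause : ∀ {D} → D ∈ H → ψ ⊨ D
    ψ⊨H-clause D∈H v sψ = All.lookup (ψ⇒H v sψ) D∈H

    GuardOf : Clause → Clause → Set
    GuardOf E Q = Q ∈ H × ∃ λ k → k < m × Q ≈C (x⁻ k ∷ E)

    PositiveOf : ℕ → Clause → Set
    PositiveOf j Q = Q ∈ H × x⁺ j ∈ Q × (∀ {k} → k < m → x⁺ k ∈ Q → k ≡ j)

    -- Deriving ¬x₀ (or ⊥) from ¬E can only pass through clauses of H inside E ∪ {¬xₖ}, and a clause with
    -- two different ¬xₖ can never be reduced to a unit; so some clause of H lies inside ¬xₖ ∨ E.
    module Guard {E : Clause} (pE : PrimeImplicate φ E) where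

      private
        ntE : NonTaut E
        ntE = proj₁ pE
        φ⊨E : φ ⊨ E
        φ⊨E = proj₁ (proj₂ pE)

      F : CNF
      F = H ++ units (map compl E)

      F⊨x⁻0 : F ⊨ (x⁻ 0 ∷ [])
      F⊨x⁻0 v s with v (x 0) in x0
      ... | false = here (cong not x0)
      ... | true with e , e∈E , et ← find (φ⊨E v (Sat-ψ⇒Sat-φ (H⇒ψ v (All.++⁻ˡ H s)) 0<m x0)) =
        ⊥-elim (¬both-true v e et (Sat-units⁻ (map compl E) (All.++⁻ʳ H s) (∈-map⁺ compl e∈E)))

      InEX⁻ : Lit → Set
      InEX⁻ l = l ∈ E ⊎ ∃ λ k → k < m × l ≡ x⁻ k

      TwoX⁻ : Clause → Set
      TwoX⁻ D = ∃ λ a → ∃ λ b → a < m × b < m × a ≢ b × x⁻ a ∈ D × x⁻ b ∈ D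

      ¬TwoX⁻-unit : ∀ {u D} → IsUnit u D → ¬ TwoX⁻ D
      ¬TwoX⁻-unit (_ , D≡u) (a , b , a<m , b<m , a≢b , x⁻a∈D , x⁻b∈D) =
        a≢b (x-injective _ _ a<m b<m (cong var (trans (All.lookup D≡u x⁻a∈D) (sym (All.lookup D≡u x⁻b∈D)))))

      Almost : Set
      Almost = ∃ λ Q → Q ∈ H × ∃ λ k → k < m × Q ⊆C (x⁻ k ∷ E)

      x⁻∉E : ∀ {k} → k < m → x⁻ k ∉ E
      x⁻∉E k<m x⁻k∈E = prime-x-free pE x⁻k∈E (_ , k<m , refl)

      E̅-no-x⁺ : ∀ {k} → k < m → x⁺ k ∉ map compl E
      E̅-no-x⁺ k<m x⁺k∈E̅ = prime-x-free pE (∈-map-compl⁻ x⁺k∈E̅) (_ , k<m , refl)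

      H-clause : ∀ {D} → D ∈ H → (∀ {l} → l ∈ D → InEX⁻ l) → Almost ⊎ TwoX⁻ D
      H-clause {D} D∈H D⊆ with ∃<? m (λ k → x⁻ k ∈? D)
      ... | no ∄x⁻ = ⊥-elim (ψ⊭-without-x⁻ (NonTaut-⊆ D⊆E ntE) (λ k<m x⁻k∈D → ∄x⁻ (_ , k<m , x⁻k∈D)) (ψ⊨H-clause D∈H))
        where
        D⊆E : D ⊆C E
        D⊆E d∈D with D⊆ d∈D
        ... | inj₁ d∈E = d∈E
        ... | inj₂ (k , k<m , refl) = ⊥-elim (∄x⁻ (k , k<m , d∈D))
      ... | yes (k , k<m , x⁻k∈D) with All.all? (_∈? x⁻ k ∷ E) D
      ...   | yes D⊆x⁻k∷E = inj₁ (D , D∈H , k , k<m , All.lookup D⊆x⁻k∷E)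
      ...   | no D⊈x⁻k∷E with l , l∈D , l∉ ← find (¬All⇒Any¬ (_∈? x⁻ k ∷ E) D D⊈x⁻k∷E) with D⊆ l∈D
      ...     | inj₁ l∈E = ⊥-elim (l∉ (there l∈E))
      ...     | inj₂ (b , b<m , refl) = inj₂ (k , b , k<m , b<m , (λ { refl → l∉ (here refl) }) , x⁻k∈D , l∈D)

      TwoX⁻-remove : ∀ {l C} → l ∈ E → TwoX⁻ C → TwoX⁻ (remove l C)
      TwoX⁻-remove l∈E (a , b , a<m , b<m , a≢b , x⁻a∈C , x⁻b∈C) =
        a , b , a<m , b<m , a≢b , ∈-remove⁺ x⁻a∈C (x⁻≢ a<m) , ∈-remove⁺ x⁻b∈C (x⁻≢ b<m)
        where
        x⁻≢ : ∀ {k} → k < m → x⁻ k ≢ _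
        x⁻≢ k<m refl = x⁻∉E k<m l∈E

      invariant : ∀ {D} → F ⊢₁ D → (∀ {l} → l ∈ D → InEX⁻ l) → Almost ⊎ TwoX⁻ D
      invariant (axiom D∈F) D⊆ with ∈-++⁻ H D∈F
      ... | inj₁ D∈H = H-clause D∈H D⊆
      ... | inj₂ D∈units with a , a∈E̅ , refl ← ∈-map⁻ (_∷ []) D∈units with D⊆ (here refl)
      ...   | inj₁ a∈E = ⊥-elim (ntE a∈E (∈-map-compl⇒compl∈ a∈E̅))
      ...   | inj₂ (k , k<m , refl) = ⊥-elim (prime-x-free pE (∈-map-compl⇒compl∈ a∈E̅) (k , k<m , refl))
      invariant (unitRes {C} {U} {l} ⊢C l∈C ⊢U unitU) D⊆
        with forced-literal ψ⇒H (NonTaut-map-compl ntE) E̅-no-x⁺ (⊢₁lit-sound (U , ⊢U , unitU))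
      ... | inj₂ (k , k<m , l̅≡x⁻k)
        with invariant ⊢U (λ u∈U → inj₂ (k , k<m , trans (All.lookup (proj₂ unitU) u∈U) l̅≡x⁻k))
      ...   | inj₁ almost = inj₁ almost
      ...   | inj₂ two = ⊥-elim (¬TwoX⁻-unit unitU two)
      invariant (unitRes {C} {U} {l} ⊢C l∈C ⊢U unitU) D⊆ | inj₁ l̅∈E̅
        with invariant ⊢C (λ {c} c∈C → case c ≟L l of λ
               { (yes refl) → inj₁ (∈-map-compl⁻ l̅∈E̅)
               ; (no c≢l) → D⊆ (∈-remove⁺ c∈C c≢l) })
      ... | inj₁ almost = inj₁ almost
      ... | inj₂ two = inj₂ (TwoX⁻-remove (∈-map-compl⁻ l̅∈E̅) two)

      almost : Almost
      almost with H-propagates (map compl E) (NonTaut-map-compl ntE) (x⁻ 0) F⊨x⁻0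
      ... | inj₁ (D , ⊢D , unitD) with invariant ⊢D (λ d∈D → inj₂ (0 , 0<m , All.lookup (proj₂ unitD) d∈D))
      ...   | inj₁ almost = almost
      ...   | inj₂ two = ⊥-elim (¬TwoX⁻-unit unitD two)
      almost | inj₂ ⊢[] with invariant ⊢[] (λ ())
      ...   | inj₁ almost = almost
      ...   | inj₂ (_ , _ , _ , _ , _ , () , _)

      guard-of : Σ Clause (GuardOf E)
      guard-of = let Q , Q∈H , k , k<m , Q⊆ = almost in
        Q , Q∈H , k , k<m , Q⊆ , ψ⊨⊆x⁻∷E⇒⊇ k<m pE Q⊆ (ψ⊨H-clause Q∈H)

    -- M satisfies H and xₐ but no ¬xₖ, so no ¬xₖ is derivable and a positive literal xₖ with k ≢ j can
    -- never be resolved away on the way to the unit xⱼ.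
    module Positive {j : ℕ} (j<m : j < m) where

      a : ℕ
      a = proj₁ (other-index j<m)

      a<m : a < m
      a<m = proj₁ (proj₂ (other-index j<m))

      a≢j : a ≢ j
      a≢j = proj₂ (proj₂ (other-index j<m))

      F : CNF
      F = H ++ units (x⁺ a ∷ [])

      M : Assignment
      M = setX true (proj₁ φ-satisfiable)

      M⊨F : Sat M F
      M⊨F = All.++⁺ (ψ⇒H M (Sat-ψ-lift (proj₂ φ-satisfiable))) (here (setX-x true _ a<m) ∷ [])

      F⊨x⁺j : F ⊨ (x⁺ j ∷ [])
      F⊨x⁺j v s = here (cycle-true ψ-cycle (H⇒ψ v (All.++⁻ˡ H s)) a<m (Sat-units⁻ (x⁺ a ∷ []) (All.++⁻ʳ H s) (here refl)) j<m)

      x⁻-underivable : ∀ {k} → k < m → ¬ (F ⊢₁lit x⁻ k)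
      x⁻-underivable k<m ⊢x⁻k with () ← trans (sym (singleton⁻ (⊢₁lit-sound ⊢x⁻k M M⊨F))) (cong not (setX-x true _ k<m))

      invariant : ∀ {D} → F ⊢₁ D → x⁺ j ∈ D → (∀ {k} → k < m → x⁺ k ∈ D → k ≡ j) → Σ Clause (PositiveOf j)
      invariant {D} (axiom D∈F) x⁺j∈D only-j with ∈-++⁻ H D∈F
      ... | inj₁ D∈H = D , D∈H , x⁺j∈D , only-j
      ... | inj₂ (here refl) with here x⁺j≡x⁺a ← x⁺j∈D = ⊥-elim (a≢j (x-injective _ _ a<m j<m (sym (cong var x⁺j≡x⁺a))))
      invariant (unitRes {C} {U} {l} ⊢C l∈C ⊢U unitU) x⁺j∈D only-j =
        invariant ⊢C (proj₁ (∈-remove⁻ C x⁺j∈D)) only-j′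
        where
        only-j′ : ∀ {k} → k < m → x⁺ k ∈ C → k ≡ j
        only-j′ {k} k<m x⁺k∈C with x⁺ k ≟L l
        ... | yes refl = ⊥-elim (x⁻-underivable k<m (U , ⊢U , unitU))
        ... | no x⁺k≢l = only-j k<m (∈-remove⁺ x⁺k∈C x⁺k≢l)

      positive-of : Σ Clause (PositiveOf j)
      positive-of with H-propagates (x⁺ a ∷ []) (λ { (here refl) (here ()) }) (x⁺ j) F⊨x⁺j
      ... | inj₁ (d ∷ D , ⊢D , _ , d≡x⁺j ∷ D≡x⁺j) =
        invariant ⊢D (here (sym d≡x⁺j)) λ k<m x⁺k∈D → x-injective _ _ k<m j<m (cong var (All.lookup (d≡x⁺j ∷ D≡x⁺j) x⁺k∈D))
      ... | inj₁ ([] , _ , []≢[] , _) = contradiction refl []≢[]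
      ... | inj₂ ⊢[] with () ← ⊢₁-sound ⊢[] M M⊨F

    guards : All (λ E → Σ Clause (GuardOf E)) L
    guards = All.tabulate (Guard.guard-of ∘′ L-prime-at)

    positives : All (λ j → Σ Clause (PositiveOf j)) (upTo m)
    positives = All.tabulate (Positive.positive-of ∘′ ∈-upTo⁻)

    chosen : List Clause
    chosen = witnesses guards ++ witnesses positives

    length-chosen : length chosen ≡ length L + m
    length-chosen = trans (length-++ (witnesses guards))
      (cong₂ _+_ (length-witnesses guards) (trans (length-witnesses positives) (length-upTo m)))

    chosen⊆H : chosen ⊆ H
    chosen⊆H Q∈ with ∈-++⁻ (witnesses guards) Q∈
    ... | inj₁ Q∈guards = proj₁ (proj₂ (proj₂ (∈-witnesses⁻ guards Q∈guards)))
    ... | inj₂ Q∈positives = proj₁ (proj₂ (proj₂ (∈-witnesses⁻ positives Q∈positives)))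

    chosen-Unique : Unique chosen
    chosen-Unique = Unique-++⁺ (witnesses-Unique guards L-distinct guards-differ)
      (witnesses-Unique positives (upTo⁺ m) positives-differ) guards∩positives=∅
      where
      guards-differ : ∀ {E E′ Q Q′} → E ∈ L → E′ ∈ L → ¬ (E ≈C E′) → GuardOf E Q → GuardOf E′ Q′ → Q ≢ Q′
      guards-differ E∈L E′∈L E≉E′ (_ , k , k<m , Q⊆ , Q⊇) (_ , k′ , k′<m , Q′⊆ , Q′⊇) refl =
        E≉E′ (drop-x⁻ k′<m (L-x-free E∈L) (Q′⊆ ∘′ Q⊇) , drop-x⁻ k<m (L-x-free E′∈L) (Q⊆ ∘′ Q′⊇))
      positives-differ : ∀ {j j′ Q Q′} → j ∈ upTo m → j′ ∈ upTo m → j ≢ j′ → PositiveOf j Q → PositiveOf j′ Q′ → Q ≢ Q′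
      positives-differ j∈ _ j≢j′ (_ , x⁺j∈Q , _) (_ , _ , only-j′) refl = j≢j′ (only-j′ (∈-upTo⁻ j∈) x⁺j∈Q)
      guards∩positives=∅ : ∀ {Q} → ¬ (Q ∈ witnesses guards × Q ∈ witnesses positives)
      guards∩positives=∅ (Q∈guards , Q∈positives)
        with E , E∈L , _ , _ , _ , Q⊆ , _ ← ∈-witnesses⁻ guards Q∈guards
           | j , j∈ , _ , x⁺j∈Q , _ ← ∈-witnesses⁻ positives Q∈positives
        with Q⊆ x⁺j∈Q
      ... | there x⁺j∈E = L-x-free E∈L x⁺j∈E (j , ∈-upTo⁻ j∈ , refl)

    size-bound : length L + m ≤ length H
    size-bound = subst (_≤ length H) length-chosen (Unique-⊆⇒length≤ (≡-dec _≟L_) chosen-Unique chosen⊆H)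

  ψ-PC-size : MinPCSize ψ (length L + m)
  ψ-PC-size = (G , G-PC , length-G) , λ H H-PC → Lower-bound.size-bound H-PC

lemma1 : (m : ℕ) → 2 ≤ m → (C : ℕ → Clause) → (x : ℕ → ℕ) → (p : ℕ) →
    Satisfiable (phi m C) →
    NumPrimeImplicates (phi m C) p →
    (∀ i j → i < m → j < m → x i ≡ x j → i ≡ j) →
    (∀ i → i < m → ¬ OccursIn (x i) (phi m C)) →
    NumPrimeImplicates (psi m C x) (m * p + m * (m ∸ 1)) × MinPCSize (psi m C x) (p + m)
lemma1 m 2≤m C x _ φ-satisfiable (L , refl , L-prime , L-complete , L-distinct) x-injective x-fresh =
  ψ-prime-count , ψ-PC-size
  where
  open Construction m 2≤m C x x-injective x-fresh φ-satisfiable L L-prime L-complete L-distinct
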